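{- Let $\mathbb{L}$ be a (not necessarily commutative) ring with unity. Let $V$ be a finite set and $n=|V|$. For each $s\in V$, let $x_s\in\mathbb{L}$. Let $X,Y\in\mathbb{L}$ be such that $X+Y$ lies in the center of $\mathbb{L}$. Then \[ \sum_{S\subseteq V}\Big(X+\sum_{s\in S}x_s\Big)^{|S|}\Big(Y-\sum_{s\in S}x_s\Big)^{n-|S|}=\sum_{\substack{i_1,i_2,\ldots,i_k\text{ are}\\ \text{distinct elements of }V}}(X+Y)^{n-k}\,x_{i_1}x_{i_2}\cdots x_{i_k}. \]
   Context: The sum on the right-hand side ranges over all nonnegative integers $k$ and all $k$-tuples $(i_1,\ldots,i_k)$ of pairwise distinct elements of $V$; in particular it contains the addend for $k=0$ and the empty tuple, which equals $(X+Y)^n$ (the empty product being $1$). -}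

module Defs where

open import Level using (Level)
import Level
open import Algebra.Bundles using (Ring)
open import Data.Nat using (ℕ; zero; suc; _∸_)
open import Data.Fin using (Fin)
open import Data.Fin.Properties using (_≟_)
open import Data.Fin.Subset using (Subset; inside; outside; ∣_∣)
open import Data.Bool using (if_then_else_)
open import Data.Vec using (Vec; []; _∷_; lookup)
open import Data.List using (List; []; _∷_; _++_; map; concatMap; allFin; upTo; filter; foldr)

allSubsets : (n : ℕ) → List (Subset n)
allSubsets zero    = [] ∷ []
allSubsets (suc n) = map (inside ∷_) (allSubsets n) ++ map (outside ∷_) (allSubsets n)

allTuples : (n k : ℕ) → List (List (Fin n))
allTuples n zero    = [] ∷ []
allTuples n (suc k) = concatMap (λ i → map (i ∷_) (allTuples n k)) (allFin n)

module _ {c ℓ : Level} (R : Ring c ℓ) where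
  open Ring R

  Σ[_]_ : {A : Set} → List A → (A → Carrier) → Carrier
  Σ[ xs ] f = foldr (λ a r → f a + r) 0# xs

  prodL : {A : Set} → (A → Carrier) → List A → Carrier
  prodL f []       = 1#
  prodL f (a ∷ as) = f a * prodL f as

  pow : Carrier → ℕ → Carrier
  pow z zero    = 1#
  pow z (suc k) = z * pow z k

  sumOver : {n : ℕ} → (Fin n → Carrier) → Subset n → Carrier
  sumOver {n} x S = Σ[ allFin n ] (λ s → if lookup S s then x s else 0#)

  Central : Carrier → Set (c Level.⊔ ℓ)
  Central z = ∀ w → z * w ≈ w * z

-- Write Z = X + Y and A_S = X + x_S, so that Y - x_S = Z - A_S, and put
--   L_p(n, x, X) = Σ_S A_S^(p+|S|) (Z - A_S)^(n-|S|).
-- Splitting an injective tuple into its first entry and the rest shows that the right-hand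
-- side E_n(x) satisfies E_0 = 1 and E_(n+1)(x) = Z^(n+1) + Σ_i x_i E_n(x with x_i removed). Splitting on 0 ∈ S and using the identity
-- A^a (Z - A)^(b+1) + A^(a+1) (Z - A)^b = Z A^a (Z - A)^b, which needs Z central, gives
--   L_p(n+1, x, X) + L_(p+1)(n, x', X) = Z L_p(n, x', X) + L_(p+1)(n, x', X + x_0),
-- where x' = (x_1, ..., x_n). Peeling one factor A_S = X + Σ_(i∈S) x_i gives
--   L_(p+1)(n+1, x, X) = X L_p(n+1, x, X) + Σ_i x_i L_(p+1)(n, x with x_i removed, X + x_i).
-- A simultaneous induction on n then proves L_0(n, x, X) = E_n(x) together with
--   L_1(n, x', X + x_0) + Z E_n(x') = E_(n+1)(x) + L_1(n, x', X).

{-# OPTIONS --safe #-}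
module Submission where

open import Defs
open import Level using (Level; _⊔_)
open import Algebra.Bundles using (Ring)
open import Data.Nat using (ℕ; zero; suc; _∸_) renaming (_+_ to _+ℕ_)
import Data.Nat.Properties as ℕ
open import Data.Fin using (Fin; zero; suc; punchIn)
open import Data.Fin.Properties using (_≟_; punchIn-injective; punchInᵢ≢i)
open import Data.Fin.Subset using (Subset; inside; outside; ∣_∣)
open import Data.Fin.Subset.Properties using (∣p∣≤n)
open import Data.Bool using (Bool; true; false; if_then_else_)
open import Data.Vec using (_∷_; lookup; insertAt)
open import Data.Vec.Properties using (insertAt-lookup; insertAt-punchIn)
open import Data.List using (List; []; _∷_; _++_; [_]; map; concatMap; allFin; upTo; filter)
open import Data.List.Properties using (map-++; ++-assoc; map-tabulate; map-applyUpTo; filter-none)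
open import Data.List.Membership.Propositional.Properties using (∈-++⁺ˡ; ∈-++⁺ʳ)
open import Data.List.Relation.Unary.All as All using ()
open import Data.List.Relation.Unary.All.Properties using () renaming (map⁺ to All-map⁺)
open import Data.List.Relation.Unary.Any using (here)
open import Data.List.Relation.Unary.AllPairs using (_∷_)
open import Data.List.Relation.Unary.Unique.Propositional using (Unique)
open import Data.List.Relation.Unary.Unique.Propositional.Properties as Unique using (Unique[x∷xs]⇒x∉xs)
open import Data.List.Relation.Unary.Unique.DecPropositional using (unique?)
open import Function using (_∘_; id; _⇔_; mk⇔)
open import Relation.Binary.PropositionalEquality as ≡ using (_≡_)
open import Relation.Nullary using (Dec; does)
open import Relation.Nullary.Decidable using (does-⇔)

∣insertAt-inside∣ : {n : ℕ} (S : Subset n) (i : Fin (suc n)) → ∣ insertAt S i inside ∣ ≡ suc ∣ S ∣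
∣insertAt-inside∣ S           zero    = ≡.refl
∣insertAt-inside∣ (true ∷ S)  (suc i) = ≡.cong suc (∣insertAt-inside∣ S i)
∣insertAt-inside∣ (false ∷ S) (suc i) = ∣insertAt-inside∣ S i

Unique-punchIn⇔ : {n : ℕ} (i : Fin (suc n)) (ys : List (Fin n)) → Unique (i ∷ map (punchIn i) ys) ⇔ Unique ys
Unique-punchIn⇔ i ys = mk⇔
  (λ { (_ ∷ u) → Unique.map⁻ u })
  (λ u → All-map⁺ (All.universal (λ j → punchInᵢ≢i i j ∘ ≡.sym) ys)
       ∷ Unique.map⁺ (punchIn-injective i _ _) u)

freshTuples : {n : ℕ} → List (Fin n) → ℕ → List (List (Fin n))
freshTuples {n} as k = filter (λ t → unique? _≟_ (as ++ t)) (allTuples n k)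

module FiniteSums {c ℓ : Level} (R : Ring c ℓ) where
  open Ring R hiding (zero)
  open import Algebra.Properties.Ring R using (-‿+-comm)
  open import Algebra.Properties.CommutativeSemigroup +-commutativeSemigroup using (x∙yz≈y∙xz; interchange)
  open import Relation.Binary.Reasoning.Setoid setoid

  Σ : {A : Set} → List A → (A → Carrier) → Carrier
  Σ = Σ[_]_ R

  _^_ : Carrier → ℕ → Carrier
  _^_ = pow R

  Σ-cong : {A : Set} (xs : List A) {f g : A → Carrier} → (∀ a → f a ≈ g a) → Σ xs f ≈ Σ xs g
  Σ-cong []       f≈g = refl
  Σ-cong (a ∷ xs) f≈g = +-cong (f≈g a) (Σ-cong xs f≈g)

  Σ-zero : {A : Set} (xs : List A) → Σ xs (λ _ → 0#) ≈ 0#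
  Σ-zero []       = refl
  Σ-zero (a ∷ xs) = trans (+-identityˡ _) (Σ-zero xs)

  Σ-++ : {A : Set} (xs ys : List A) (f : A → Carrier) → Σ (xs ++ ys) f ≈ Σ xs f + Σ ys f
  Σ-++ []       ys f = sym (+-identityˡ _)
  Σ-++ (a ∷ xs) ys f = trans (+-congˡ (Σ-++ xs ys f)) (sym (+-assoc _ _ _))

  Σ-map : {A B : Set} (h : A → B) (xs : List A) (f : B → Carrier) → Σ (map h xs) f ≡ Σ xs (f ∘ h)
  Σ-map h []       f = ≡.refl
  Σ-map h (a ∷ xs) f = ≡.cong (f (h a) +_) (Σ-map h xs f)

  Σ-concatMap : {A B : Set} (h : A → List B) (xs : List A) (f : B → Carrier) →
    Σ (concatMap h xs) f ≈ Σ xs (λ a → Σ (h a) f)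
  Σ-concatMap h []       f = refl
  Σ-concatMap h (a ∷ xs) f = trans (Σ-++ (h a) (concatMap h xs) f) (+-congˡ (Σ-concatMap h xs f))

  Σ-filter : {A : Set} {p : Level} {P : A → Set p} (P? : ∀ a → Dec (P a)) (xs : List A) (f : A → Carrier) →
    Σ (filter P? xs) f ≈ Σ xs (λ a → if does (P? a) then f a else 0#)
  Σ-filter P? []       f = refl
  Σ-filter P? (a ∷ xs) f with does (P? a)
  ... | true  = +-congˡ (Σ-filter P? xs f)
  ... | false = trans (Σ-filter P? xs f) (sym (+-identityˡ _))

  Σ-+ : {A : Set} (xs : List A) (f g : A → Carrier) → Σ xs (λ a → f a + g a) ≈ Σ xs f + Σ xs g
  Σ-+ []       f g = sym (+-identityˡ _)
  Σ-+ (a ∷ xs) f g = trans (+-congˡ (Σ-+ xs f g)) (interchange _ _ _ _)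

  Σ-*ˡ : {A : Set} (xs : List A) (z : Carrier) (f : A → Carrier) → Σ xs (λ a → z * f a) ≈ z * Σ xs f
  Σ-*ˡ []       z f = sym (zeroʳ z)
  Σ-*ˡ (a ∷ xs) z f = trans (+-congˡ (Σ-*ˡ xs z f)) (sym (distribˡ _ _ _))

  Σ-*ʳ : {A : Set} (xs : List A) (z : Carrier) (f : A → Carrier) → Σ xs (λ a → f a * z) ≈ Σ xs f * z
  Σ-*ʳ []       z f = sym (zeroˡ z)
  Σ-*ʳ (a ∷ xs) z f = trans (+-congˡ (Σ-*ʳ xs z f)) (sym (distribʳ _ _ _))

  Σ-swap : {A B : Set} (xs : List A) (ys : List B) (f : A → B → Carrier) →
    Σ xs (λ a → Σ ys (f a)) ≈ Σ ys (λ b → Σ xs (λ a → f a b))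
  Σ-swap []       ys f = sym (Σ-zero ys)
  Σ-swap (a ∷ xs) ys f = trans (+-congˡ (Σ-swap xs ys f)) (sym (Σ-+ ys (f a) _))

  Σ-*-+ : {A : Set} (xs : List A) (f g h : A → Carrier) →
    Σ xs (λ a → f a * (g a + h a)) ≈ Σ xs (λ a → f a * g a) + Σ xs (λ a → f a * h a)
  Σ-*-+ xs f g h = trans (Σ-cong xs (λ a → distribˡ (f a) (g a) (h a))) (Σ-+ xs _ _)

  *-Σ-central : {z : Carrier} → Central R z → {A : Set} (xs : List A) (f g : A → Carrier) →
    z * Σ xs (λ a → f a * g a) ≈ Σ xs (λ a → f a * (z * g a))
  *-Σ-central {z} z-central xs f g = trans (sym (Σ-*ˡ xs z _)) (Σ-cong xs λ a → begin
    z * (f a * g a)   ≈⟨ *-assoc z (f a) (g a) ⟨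
    (z * f a) * g a   ≈⟨ *-congʳ (z-central (f a)) ⟩
    (f a * z) * g a   ≈⟨ *-assoc (f a) z (g a) ⟩
    f a * (z * g a)   ∎)

  Σ-allFin-suc : {n : ℕ} (g : Fin (suc n) → Carrier) → Σ (allFin (suc n)) g ≡ g zero + Σ (allFin n) (g ∘ suc)
  Σ-allFin-suc {n} g = ≡.cong (g zero +_)
    (≡.trans (≡.cong (λ l → Σ l g) (≡.sym (map-tabulate id suc))) (Σ-map suc (allFin n) g))

  Σ-allFin-punchIn : {n : ℕ} (i : Fin (suc n)) (g : Fin (suc n) → Carrier) →
    Σ (allFin (suc n)) g ≈ g i + Σ (allFin n) (g ∘ punchIn i)
  Σ-allFin-punchIn zero g = reflexive (Σ-allFin-suc g)
  Σ-allFin-punchIn {suc n} (suc i) g = begin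
    Σ (allFin (suc (suc n))) g
      ≡⟨ Σ-allFin-suc g ⟩
    g zero + Σ (allFin (suc n)) (g ∘ suc)
      ≈⟨ +-congˡ (Σ-allFin-punchIn i (g ∘ suc)) ⟩
    g zero + (g (suc i) + Σ (allFin n) (g ∘ suc ∘ punchIn i))
      ≈⟨ x∙yz≈y∙xz _ _ _ ⟩
    g (suc i) + (g zero + Σ (allFin n) (g ∘ suc ∘ punchIn i))
      ≡⟨ ≡.cong (g (suc i) +_) (Σ-allFin-suc (g ∘ punchIn (suc i))) ⟨
    g (suc i) + Σ (allFin (suc n)) (g ∘ punchIn (suc i)) ∎

  Σ-upTo-suc : (n : ℕ) (g : ℕ → Carrier) → Σ (upTo (suc n)) g ≡ g 0 + Σ (upTo n) (g ∘ suc)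
  Σ-upTo-suc n g = ≡.cong (g 0 +_)
    (≡.trans (≡.cong (λ l → Σ l g) (≡.sym (map-applyUpTo id suc n))) (Σ-map suc (upTo n) g))

  if-*≈*-if : (b : Bool) (a d : Carrier) → (if b then a else 0#) * d ≈ a * (if b then d else 0#)
  if-*≈*-if true  a d = refl
  if-*≈*-if false a d = trans (zeroˡ d) (sym (zeroʳ a))

  [x+y]-[x+z]≈y-z : ∀ x y z → (x + y) - (x + z) ≈ y - z
  [x+y]-[x+z]≈y-z x y z = begin
    (x + y) + - (x + z)   ≈⟨ +-congˡ (-‿+-comm x z) ⟨
    (x + y) + (- x + - z) ≈⟨ interchange x y (- x) (- z) ⟩
    (x - x) + (y - z)     ≈⟨ +-congʳ (-‿inverseʳ x) ⟩
    0# + (y - z)          ≈⟨ +-identityˡ _ ⟩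
    y - z                 ∎

  ^-cong : {a b : Carrier} (k : ℕ) → a ≈ b → a ^ k ≈ b ^ k
  ^-cong zero    a≈b = refl
  ^-cong (suc k) a≈b = *-cong a≈b (^-cong k a≈b)

  *-^-comm : {a b : Carrier} (k : ℕ) → a * b ≈ b * a → a * b ^ k ≈ b ^ k * a
  *-^-comm zero    ab≈ba = trans (*-identityʳ _) (sym (*-identityˡ _))
  *-^-comm {a} {b} (suc k) ab≈ba = begin
    a * (b * b ^ k)   ≈⟨ *-assoc a b _ ⟨
    (a * b) * b ^ k   ≈⟨ *-congʳ ab≈ba ⟩
    (b * a) * b ^ k   ≈⟨ *-assoc b a _ ⟩
    b * (a * b ^ k)   ≈⟨ *-congˡ (*-^-comm k ab≈ba) ⟩
    b * (b ^ k * a)   ≈⟨ *-assoc b _ a ⟨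
    (b * b ^ k) * a   ∎

  ^-central : {z : Carrier} (k : ℕ) → Central R z → Central R (z ^ k)
  ^-central k z-central w = sym (*-^-comm k (sym (z-central w)))

  Σ-allSubsets-suc : {n : ℕ} (f : Subset (suc n) → Carrier) →
    Σ (allSubsets (suc n)) f ≈ Σ (allSubsets n) (f ∘ (inside ∷_)) + Σ (allSubsets n) (f ∘ (outside ∷_))
  Σ-allSubsets-suc {n} f = trans (Σ-++ (map (inside ∷_) (allSubsets n)) _ f)
    (+-cong (reflexive (Σ-map (inside ∷_) (allSubsets n) f)) (reflexive (Σ-map (outside ∷_) (allSubsets n) f)))

  Σ-allSubsets-∋ : {n : ℕ} (i : Fin (suc n)) (h : Subset (suc n) → Carrier) →
    Σ (allSubsets (suc n)) (λ S → if lookup S i then h S else 0#) ≈ Σ (allSubsets n) (λ S → h (insertAt S i inside))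
  Σ-allSubsets-∋ {n} zero h = begin
    Σ (allSubsets (suc n)) (λ S → if lookup S zero then h S else 0#)  ≈⟨ Σ-allSubsets-suc {n} _ ⟩
    Σ (allSubsets n) (h ∘ (inside ∷_)) + Σ (allSubsets n) (λ _ → 0#) ≈⟨ +-congˡ (Σ-zero (allSubsets n)) ⟩
    Σ (allSubsets n) (h ∘ (inside ∷_)) + 0#                           ≈⟨ +-identityʳ _ ⟩
    Σ (allSubsets n) (h ∘ (inside ∷_))                                ∎
  Σ-allSubsets-∋ {suc n} (suc i) h = begin
    Σ (allSubsets (suc (suc n))) (λ S → if lookup S (suc i) then h S else 0#)
      ≈⟨ Σ-allSubsets-suc {suc n} _ ⟩
    Σ (allSubsets (suc n)) (λ S → if lookup S i then h (inside ∷ S) else 0#)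
      + Σ (allSubsets (suc n)) (λ S → if lookup S i then h (outside ∷ S) else 0#)
      ≈⟨ +-cong (Σ-allSubsets-∋ i (h ∘ (inside ∷_))) (Σ-allSubsets-∋ i (h ∘ (outside ∷_))) ⟩
    Σ (allSubsets n) (λ S → h (inside ∷ insertAt S i inside))
      + Σ (allSubsets n) (λ S → h (outside ∷ insertAt S i inside))
      ≈⟨ Σ-allSubsets-suc {n} (λ S → h (insertAt S (suc i) inside)) ⟨
    Σ (allSubsets (suc n)) (λ S → h (insertAt S (suc i) inside)) ∎

  sumOver-outside : {n : ℕ} (x : Fin (suc n) → Carrier) (S : Subset n) →
    sumOver R x (outside ∷ S) ≈ sumOver R (x ∘ suc) S
  sumOver-outside x S = trans (reflexive (Σ-allFin-suc (λ s → if lookup (outside ∷ S) s then x s else 0#)))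
                                (+-identityˡ _)

  sumOver-insertAt-inside : {n : ℕ} (x : Fin (suc n) → Carrier) (S : Subset n) (i : Fin (suc n)) →
    sumOver R x (insertAt S i inside) ≈ x i + sumOver R (x ∘ punchIn i) S
  sumOver-insertAt-inside {n} x S i = begin
    sumOver R x (insertAt S i inside)
      ≈⟨ Σ-allFin-punchIn i _ ⟩
    (if lookup (insertAt S i inside) i then x i else 0#)
      + Σ (allFin n) (λ j → if lookup (insertAt S i inside) (punchIn i j) then x (punchIn i j) else 0#)
      ≈⟨ +-cong (reflexive (≡.cong (λ b → if b then x i else 0#) (insertAt-lookup S i inside)))
                (Σ-cong (allFin n) (λ j → reflexive
                  (≡.cong (λ b → if b then x (punchIn i j) else 0#) (insertAt-punchIn S i inside j)))) ⟩
    x i + sumOver R (x ∘ punchIn i) S ∎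

  Σ-sumOver-* : {n : ℕ} (x : Fin (suc n) → Carrier) (h : Subset (suc n) → Carrier) →
    Σ (allSubsets (suc n)) (λ S → sumOver R x S * h S)
      ≈ Σ (allFin (suc n)) (λ i → x i * Σ (allSubsets n) (λ S → h (insertAt S i inside)))
  Σ-sumOver-* {n} x h = begin
    Σ (allSubsets (suc n)) (λ S → sumOver R x S * h S)
      ≈⟨ Σ-cong (allSubsets (suc n)) (λ S → Σ-*ʳ (allFin (suc n)) (h S) _) ⟨
    Σ (allSubsets (suc n)) (λ S → Σ (allFin (suc n)) (λ i → (if lookup S i then x i else 0#) * h S))
      ≈⟨ Σ-swap (allSubsets (suc n)) (allFin (suc n)) _ ⟩
    Σ (allFin (suc n)) (λ i → Σ (allSubsets (suc n)) (λ S → (if lookup S i then x i else 0#) * h S))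
      ≈⟨ Σ-cong (allFin (suc n)) (λ i → Σ-cong (allSubsets (suc n)) (λ S → if-*≈*-if (lookup S i) (x i) (h S))) ⟩
    Σ (allFin (suc n)) (λ i → Σ (allSubsets (suc n)) (λ S → x i * (if lookup S i then h S else 0#)))
      ≈⟨ Σ-cong (allFin (suc n)) (λ i → Σ-*ˡ (allSubsets (suc n)) (x i) _) ⟩
    Σ (allFin (suc n)) (λ i → x i * Σ (allSubsets (suc n)) (λ S → if lookup S i then h S else 0#))
      ≈⟨ Σ-cong (allFin (suc n)) (λ i → *-congˡ (Σ-allSubsets-∋ i h)) ⟩
    Σ (allFin (suc n)) (λ i → x i * Σ (allSubsets n) (λ S → h (insertAt S i inside))) ∎

  prodL-map : {A B : Set} (x : B → Carrier) (f : A → B) (t : List A) → prodL R x (map f t) ≡ prodL R (x ∘ f) t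
  prodL-map x f []      = ≡.refl
  prodL-map x f (a ∷ t) = ≡.cong (x (f a) *_) (prodL-map x f t)

  Σ-freshTuples-suc : {n : ℕ} (as : List (Fin n)) (k : ℕ) (w : List (Fin n) → Carrier) →
    Σ (freshTuples as (suc k)) w ≈ Σ (allFin n) (λ j → Σ (freshTuples (as ++ [ j ]) k) (w ∘ (j ∷_)))
  Σ-freshTuples-suc {n} as k w = begin
    Σ (freshTuples as (suc k)) w
      ≈⟨ Σ-filter (λ t → unique? _≟_ (as ++ t)) (allTuples n (suc k)) w ⟩
    Σ (allTuples n (suc k)) (fresh as w)
      ≈⟨ Σ-concatMap (λ j → map (j ∷_) (allTuples n k)) (allFin n) (fresh as w) ⟩
    Σ (allFin n) (λ j → Σ (map (j ∷_) (allTuples n k)) (fresh as w))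
      ≈⟨ Σ-cong (allFin n) (λ j → reflexive (Σ-map (j ∷_) (allTuples n k) (fresh as w))) ⟩
    Σ (allFin n) (λ j → Σ (allTuples n k) (λ t → fresh as w (j ∷ t)))
      ≈⟨ Σ-cong (allFin n) (λ j → Σ-cong (allTuples n k) (λ t → reflexive
           (≡.cong (λ l → if does (unique? _≟_ l) then w (j ∷ t) else 0#) (≡.sym (++-assoc as [ j ] t))))) ⟩
    Σ (allFin n) (λ j → Σ (allTuples n k) (fresh (as ++ [ j ]) (w ∘ (j ∷_))))
      ≈⟨ Σ-cong (allFin n) (λ j → Σ-filter (λ t → unique? _≟_ ((as ++ [ j ]) ++ t)) (allTuples n k) (w ∘ (j ∷_))) ⟨
    Σ (allFin n) (λ j → Σ (freshTuples (as ++ [ j ]) k) (w ∘ (j ∷_))) ∎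
    where
    fresh : List (Fin n) → (List (Fin n) → Carrier) → List (Fin n) → Carrier
    fresh bs v t = if does (unique? _≟_ (bs ++ t)) then v t else 0#

  Σ-freshTuples-punchIn : {n : ℕ} (i : Fin (suc n)) (as : List (Fin n)) (k : ℕ) (w : List (Fin (suc n)) → Carrier) →
    Σ (freshTuples (i ∷ map (punchIn i) as) k) w ≈ Σ (freshTuples as k) (w ∘ map (punchIn i))
  Σ-freshTuples-punchIn {n} i as zero w = begin
    Σ (freshTuples (i ∷ map (punchIn i) as) 0) w
      ≈⟨ Σ-filter (λ t → unique? _≟_ (i ∷ map (punchIn i) as ++ t)) (allTuples (suc n) 0) w ⟩
    (if does (unique? _≟_ (i ∷ map (punchIn i) as ++ [])) then w [] else 0#) + 0#
      ≡⟨ ≡.cong (λ b → (if b then w [] else 0#) + 0#) (≡.trans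
           (≡.cong (λ l → does (unique? _≟_ (i ∷ l))) (≡.sym (map-++ (punchIn i) as [])))
           (does-⇔ (Unique-punchIn⇔ i (as ++ [])) (unique? _≟_ _) (unique? _≟_ (as ++ [])))) ⟩
    (if does (unique? _≟_ (as ++ [])) then w [] else 0#) + 0#
      ≈⟨ Σ-filter (λ t → unique? _≟_ (as ++ t)) (allTuples n 0) (w ∘ map (punchIn i)) ⟨
    Σ (freshTuples as 0) (w ∘ map (punchIn i)) ∎
  Σ-freshTuples-punchIn {n} i as (suc k) w = begin
    Σ (freshTuples (i ∷ map (punchIn i) as) (suc k)) w
      ≈⟨ Σ-freshTuples-suc (i ∷ map (punchIn i) as) k w ⟩
    Σ (allFin (suc n)) (λ j → Σ (freshTuples ((i ∷ map (punchIn i) as) ++ [ j ]) k) (w ∘ (j ∷_)))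
      ≈⟨ Σ-allFin-punchIn i _ ⟩
    Σ (freshTuples (i ∷ (map (punchIn i) as ++ [ i ])) k) (w ∘ (i ∷_))
      + Σ (allFin n) (λ j → Σ (freshTuples (i ∷ (map (punchIn i) as ++ [ punchIn i j ])) k) (w ∘ (punchIn i j ∷_)))
      ≈⟨ +-cong (reflexive (≡.cong (λ l → Σ l (w ∘ (i ∷_))) i-repeated))
                (Σ-cong (allFin n) (λ j → reflexive (≡.cong (λ l → Σ (freshTuples (i ∷ l) k) (w ∘ (punchIn i j ∷_)))
                  (≡.sym (map-++ (punchIn i) as [ j ]))))) ⟩
    0# + Σ (allFin n) (λ j → Σ (freshTuples (i ∷ map (punchIn i) (as ++ [ j ])) k) (w ∘ (punchIn i j ∷_)))
      ≈⟨ +-identityˡ _ ⟩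
    Σ (allFin n) (λ j → Σ (freshTuples (i ∷ map (punchIn i) (as ++ [ j ])) k) (w ∘ (punchIn i j ∷_)))
      ≈⟨ Σ-cong (allFin n) (λ j → Σ-freshTuples-punchIn i (as ++ [ j ]) k (w ∘ (punchIn i j ∷_))) ⟩
    Σ (allFin n) (λ j → Σ (freshTuples (as ++ [ j ]) k) (w ∘ map (punchIn i) ∘ (j ∷_)))
      ≈⟨ Σ-freshTuples-suc as k (w ∘ map (punchIn i)) ⟨
    Σ (freshTuples as (suc k)) (w ∘ map (punchIn i)) ∎
    where
    i-repeated : freshTuples (i ∷ (map (punchIn i) as ++ [ i ])) k ≡ []
    i-repeated = filter-none (λ t → unique? _≟_ (i ∷ (map (punchIn i) as ++ [ i ]) ++ t))
      (All.universal (λ t u → Unique[x∷xs]⇒x∉xs u (∈-++⁺ˡ (∈-++⁺ʳ (map (punchIn i) as) (here ≡.refl))))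
                     (allTuples (suc n) k))

  distinctProducts : {n : ℕ} → ℕ → (Fin n → Carrier) → Carrier
  distinctProducts {n} k x = Σ (filter (unique? _≟_) (allTuples n k)) (prodL R x)

  distinctProducts-zero : {n : ℕ} (x : Fin n → Carrier) → distinctProducts 0 x ≈ 1#
  distinctProducts-zero x = +-identityʳ 1#

  distinctProducts-suc : {n : ℕ} (k : ℕ) (x : Fin (suc n) → Carrier) →
    distinctProducts (suc k) x ≈ Σ (allFin (suc n)) (λ i → x i * distinctProducts k (x ∘ punchIn i))
  distinctProducts-suc {n} k x = begin
    distinctProducts (suc k) x
      ≈⟨ Σ-freshTuples-suc [] k (prodL R x) ⟩
    Σ (allFin (suc n)) (λ i → Σ (freshTuples [ i ] k) (λ t → x i * prodL R x t))
      ≈⟨ Σ-cong (allFin (suc n)) (λ i → Σ-*ˡ (freshTuples [ i ] k) (x i) (prodL R x)) ⟩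
    Σ (allFin (suc n)) (λ i → x i * Σ (freshTuples [ i ] k) (prodL R x))
      ≈⟨ Σ-cong (allFin (suc n)) (λ i → *-congˡ (Σ-freshTuples-punchIn i [] k (prodL R x))) ⟩
    Σ (allFin (suc n)) (λ i → x i * Σ (freshTuples [] k) (prodL R x ∘ map (punchIn i)))
      ≈⟨ Σ-cong (allFin (suc n)) (λ i → *-congˡ
           (Σ-cong (freshTuples [] k) (λ t → reflexive (prodL-map x (punchIn i) t)))) ⟩
    Σ (allFin (suc n)) (λ i → x i * distinctProducts k (x ∘ punchIn i)) ∎

module AbelIdentity {c ℓ : Level} (R : Ring c ℓ) (Z : Ring.Carrier R) (Z-central : Central R Z) where
  open Ring R hiding (zero)
  open FiniteSums R
  open import Algebra.Properties.Ring R using (+-cancelʳ; //-rightDividesˡ)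
  open import Algebra.Properties.CommutativeSemigroup +-commutativeSemigroup using (xy∙z≈xz∙y)
  open import Algebra.Solver.CommutativeMonoid +-commutativeMonoid using (solve; _⊕_; _⊜_)
  open import Relation.Binary.Reasoning.Setoid setoid

  arrangementSum : (n : ℕ) → (Fin n → Carrier) → Carrier
  arrangementSum n x = Σ (upTo (suc n)) (λ k → Z ^ (n ∸ k) * distinctProducts k x)

  arrangementSum-zero : (x : Fin 0 → Carrier) → arrangementSum 0 x ≈ 1#
  arrangementSum-zero x = begin
    1# * distinctProducts 0 x + 0# ≈⟨ +-identityʳ _ ⟩
    1# * distinctProducts 0 x      ≈⟨ *-identityˡ _ ⟩
    distinctProducts 0 x           ≈⟨ distinctProducts-zero x ⟩
    1#                             ∎

  arrangementSum-suc : {n : ℕ} (x : Fin (suc n) → Carrier) →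
    arrangementSum (suc n) x ≈ Z ^ suc n + Σ (allFin (suc n)) (λ i → x i * arrangementSum n (x ∘ punchIn i))
  arrangementSum-suc {n} x = begin
    arrangementSum (suc n) x
      ≡⟨ Σ-upTo-suc (suc n) (λ k → Z ^ (suc n ∸ k) * distinctProducts k x) ⟩
    Z ^ suc n * distinctProducts 0 x + Σ ks (λ k → Z ^ (n ∸ k) * distinctProducts (suc k) x)
      ≈⟨ +-cong (trans (*-congˡ (distinctProducts-zero x)) (*-identityʳ _))
                (Σ-cong ks (λ k → *-congˡ (distinctProducts-suc k x))) ⟩
    Z ^ suc n + Σ ks (λ k → Z ^ (n ∸ k) * Σ is (λ i → x i * distinctProducts k (x ∘ punchIn i)))
      ≈⟨ +-congˡ (Σ-cong ks (λ k → *-Σ-central (^-central (n ∸ k) Z-central) is x _)) ⟩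
    Z ^ suc n + Σ ks (λ k → Σ is (λ i → x i * (Z ^ (n ∸ k) * distinctProducts k (x ∘ punchIn i))))
      ≈⟨ +-congˡ (Σ-swap ks is _) ⟩
    Z ^ suc n + Σ is (λ i → Σ ks (λ k → x i * (Z ^ (n ∸ k) * distinctProducts k (x ∘ punchIn i))))
      ≈⟨ +-congˡ (Σ-cong is (λ i → Σ-*ˡ ks (x i) _)) ⟩
    Z ^ suc n + Σ is (λ i → x i * arrangementSum n (x ∘ punchIn i)) ∎
    where
    ks : List ℕ
    ks = upTo (suc n)
    is : List (Fin (suc n))
    is = allFin (suc n)

  abelTerm : Carrier → ℕ → ℕ → Carrier
  abelTerm A a b = A ^ a * (Z - A) ^ b

  abelTerm-cong : {A A′ : Carrier} {a a′ b b′ : ℕ} →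
    A ≈ A′ → a ≡ a′ → b ≡ b′ → abelTerm A a b ≈ abelTerm A′ a′ b′
  abelTerm-cong {a = a} {b = b} A≈A′ ≡.refl ≡.refl =
    *-cong (^-cong a A≈A′) (^-cong b (+-congˡ (-‿cong A≈A′)))

  abelTerm-suc : (A : Carrier) (a b : ℕ) → abelTerm A a (suc b) + abelTerm A (suc a) b ≈ Z * abelTerm A a b
  abelTerm-suc A a b = begin
    A ^ a * ((Z - A) * (Z - A) ^ b) + (A * A ^ a) * (Z - A) ^ b
      ≈⟨ +-cong (sym (*-assoc _ _ _)) (*-congʳ (*-^-comm {A} a refl)) ⟩
    (A ^ a * (Z - A)) * (Z - A) ^ b + (A ^ a * A) * (Z - A) ^ b
      ≈⟨ distribʳ _ _ _ ⟨
    (A ^ a * (Z - A) + A ^ a * A) * (Z - A) ^ b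
      ≈⟨ *-congʳ (distribˡ _ _ _) ⟨
    (A ^ a * ((Z - A) + A)) * (Z - A) ^ b
      ≈⟨ *-congʳ (*-congˡ (//-rightDividesˡ A Z)) ⟩
    (A ^ a * Z) * (Z - A) ^ b
      ≈⟨ *-congʳ (Z-central (A ^ a)) ⟨
    (Z * A ^ a) * (Z - A) ^ b
      ≈⟨ *-assoc _ _ _ ⟩
    Z * abelTerm A a b ∎

  abelSum : ℕ → (n : ℕ) → (Fin n → Carrier) → Carrier → Carrier
  abelSum p n x X = Σ (allSubsets n) (λ S → abelTerm (X + sumOver R x S) (p +ℕ ∣ S ∣) (n ∸ ∣ S ∣))

  abelSum-cong : (p n : ℕ) (x : Fin n → Carrier) {X X′ : Carrier} → X ≈ X′ → abelSum p n x X ≈ abelSum p n x X′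
  abelSum-cong p n x X≈X′ = Σ-cong (allSubsets n) (λ S →
    abelTerm-cong {a = p +ℕ ∣ S ∣} {b = n ∸ ∣ S ∣} (+-congʳ X≈X′) ≡.refl ≡.refl)

  abelSum-zero : (p : ℕ) (x : Fin 0 → Carrier) (X : Carrier) → abelSum p 0 x X ≈ X ^ p
  abelSum-zero p x X = begin
    abelTerm (X + 0#) (p +ℕ 0) 0 + 0#  ≈⟨ +-identityʳ _ ⟩
    (X + 0#) ^ (p +ℕ 0) * 1#           ≈⟨ *-identityʳ _ ⟩
    (X + 0#) ^ (p +ℕ 0)                ≈⟨ ^-cong (p +ℕ 0) (+-identityʳ X) ⟩
    X ^ (p +ℕ 0)                       ≡⟨ ≡.cong (X ^_) (ℕ.+-identityʳ p) ⟩
    X ^ p                              ∎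

  abelSum-split : (p n : ℕ) (x : Fin (suc n) → Carrier) (X : Carrier) →
    abelSum p (suc n) x X + abelSum (suc p) n (x ∘ suc) X
      ≈ Z * abelSum p n (x ∘ suc) X + abelSum (suc p) n (x ∘ suc) (X + x zero)
  abelSum-split p n x X = begin
    abelSum p (suc n) x X + abelSum (suc p) n (x ∘ suc) X
      ≈⟨ +-congʳ (Σ-allSubsets-suc {n} (λ S → abelTerm (X + sumOver R x S) (p +ℕ ∣ S ∣) (suc n ∸ ∣ S ∣))) ⟩
    (Σ Ss with-0 + Σ Ss without-0) + Σ Ss (term (suc p))
      ≈⟨ +-assoc _ _ _ ⟩
    Σ Ss with-0 + (Σ Ss without-0 + Σ Ss (term (suc p)))
      ≈⟨ +-congˡ (Σ-+ Ss without-0 (term (suc p))) ⟨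
    Σ Ss with-0 + Σ Ss (λ S → without-0 S + term (suc p) S)
      ≈⟨ +-cong (Σ-cong Ss with-0≈) (Σ-cong Ss without-0+term≈) ⟩
    abelSum (suc p) n (x ∘ suc) (X + x zero) + Σ Ss (λ S → Z * term p S)
      ≈⟨ +-congˡ (Σ-*ˡ Ss Z (term p)) ⟩
    abelSum (suc p) n (x ∘ suc) (X + x zero) + Z * abelSum p n (x ∘ suc) X
      ≈⟨ +-comm _ _ ⟩
    Z * abelSum p n (x ∘ suc) X + abelSum (suc p) n (x ∘ suc) (X + x zero) ∎
    where
    Ss : List (Subset n)
    Ss = allSubsets n
    A : Subset n → Carrier
    A S = X + sumOver R (x ∘ suc) S
    term : ℕ → Subset n → Carrier
    term q S = abelTerm (A S) (q +ℕ ∣ S ∣) (n ∸ ∣ S ∣)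
    with-0 without-0 : Subset n → Carrier
    with-0 S = abelTerm (X + sumOver R x (inside ∷ S)) (p +ℕ suc ∣ S ∣) (n ∸ ∣ S ∣)
    without-0 S = abelTerm (X + sumOver R x (outside ∷ S)) (p +ℕ ∣ S ∣) (suc n ∸ ∣ S ∣)
    with-0≈ : ∀ S → with-0 S ≈ abelTerm ((X + x zero) + sumOver R (x ∘ suc) S) (suc p +ℕ ∣ S ∣) (n ∸ ∣ S ∣)
    with-0≈ S = abelTerm-cong {a = p +ℕ suc ∣ S ∣} {b = n ∸ ∣ S ∣}
      (trans (+-congˡ (sumOver-insertAt-inside x S zero)) (sym (+-assoc _ _ _))) (ℕ.+-suc p ∣ S ∣) ≡.refl
    without-0+term≈ : ∀ S → without-0 S + term (suc p) S ≈ Z * term p S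
    without-0+term≈ S = trans
      (+-congʳ (abelTerm-cong {a = p +ℕ ∣ S ∣} {b = suc n ∸ ∣ S ∣}
        (+-congˡ (sumOver-outside x S)) ≡.refl (ℕ.+-∸-assoc 1 (∣p∣≤n S))))
      (abelTerm-suc (A S) (p +ℕ ∣ S ∣) (n ∸ ∣ S ∣))

  abelSum-peel : (p n : ℕ) (x : Fin (suc n) → Carrier) (X : Carrier) →
    abelSum (suc p) (suc n) x X
      ≈ X * abelSum p (suc n) x X + Σ (allFin (suc n)) (λ i → x i * abelSum (suc p) n (x ∘ punchIn i) (X + x i))
  abelSum-peel p n x X = begin
    abelSum (suc p) (suc n) x X
      ≈⟨ Σ-cong Ss (λ S → trans (*-assoc _ _ _) (distribʳ (term S) X (sumOver R x S))) ⟩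
    Σ Ss (λ S → X * term S + sumOver R x S * term S)
      ≈⟨ Σ-+ Ss _ _ ⟩
    Σ Ss (λ S → X * term S) + Σ Ss (λ S → sumOver R x S * term S)
      ≈⟨ +-cong (Σ-*ˡ Ss X term) (Σ-sumOver-* x term) ⟩
    X * abelSum p (suc n) x X + Σ (allFin (suc n)) (λ i → x i * Σ (allSubsets n) (λ S → term (insertAt S i inside)))
      ≈⟨ +-congˡ (Σ-cong (allFin (suc n)) (λ i → *-congˡ (Σ-cong (allSubsets n) (term-insertAt i)))) ⟩
    X * abelSum p (suc n) x X + Σ (allFin (suc n)) (λ i → x i * abelSum (suc p) n (x ∘ punchIn i) (X + x i)) ∎
    where
    Ss : List (Subset (suc n))
    Ss = allSubsets (suc n)
    term : Subset (suc n) → Carrier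
    term S = abelTerm (X + sumOver R x S) (p +ℕ ∣ S ∣) (suc n ∸ ∣ S ∣)
    term-insertAt : ∀ i S →
      term (insertAt S i inside) ≈ abelTerm ((X + x i) + sumOver R (x ∘ punchIn i) S) (suc p +ℕ ∣ S ∣) (n ∸ ∣ S ∣)
    term-insertAt i S = abelTerm-cong {a = p +ℕ ∣ insertAt S i inside ∣} {b = suc n ∸ ∣ insertAt S i inside ∣}
      (trans (+-congˡ (sumOver-insertAt-inside x S i)) (sym (+-assoc _ _ _)))
      (≡.trans (≡.cong (p +ℕ_) (∣insertAt-inside∣ S i)) (ℕ.+-suc p ∣ S ∣))
      (≡.cong (suc n ∸_) (∣insertAt-inside∣ S i))

  AbelSum₀Formula : ℕ → Set (c ⊔ ℓ)
  AbelSum₀Formula n = (x : Fin n → Carrier) (X : Carrier) → abelSum 0 n x X ≈ arrangementSum n x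

  AbelSum₁Shift : ℕ → Set (c ⊔ ℓ)
  AbelSum₁Shift n = (x : Fin (suc n) → Carrier) (W : Carrier) →
    abelSum 1 n (x ∘ suc) (W + x zero) + Z * arrangementSum n (x ∘ suc)
      ≈ arrangementSum (suc n) x + abelSum 1 n (x ∘ suc) W

  abelSum₀Formula-zero : AbelSum₀Formula 0
  abelSum₀Formula-zero x X = trans (abelSum-zero 0 x X) (sym (arrangementSum-zero x))

  abelSum₀Formula-suc : (n : ℕ) → AbelSum₀Formula n → AbelSum₁Shift n → AbelSum₀Formula (suc n)
  abelSum₀Formula-suc n abelSum₀-n abelSum₁-shift-n x X = +-cancelʳ (abelSum 1 n (x ∘ suc) X) _ _ (begin
    abelSum 0 (suc n) x X + abelSum 1 n (x ∘ suc) X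
      ≈⟨ abelSum-split 0 n x X ⟩
    Z * abelSum 0 n (x ∘ suc) X + abelSum 1 n (x ∘ suc) (X + x zero)
      ≈⟨ +-comm _ _ ⟩
    abelSum 1 n (x ∘ suc) (X + x zero) + Z * abelSum 0 n (x ∘ suc) X
      ≈⟨ +-congˡ (*-congˡ (abelSum₀-n (x ∘ suc) X)) ⟩
    abelSum 1 n (x ∘ suc) (X + x zero) + Z * arrangementSum n (x ∘ suc)
      ≈⟨ abelSum₁-shift-n x X ⟩
    arrangementSum (suc n) x + abelSum 1 n (x ∘ suc) X ∎)

  abelSum₁Shift-zero : AbelSum₁Shift 0
  abelSum₁Shift-zero x W = begin
    abelSum 1 0 (x ∘ suc) (W + x zero) + Z * arrangementSum 0 (x ∘ suc)
      ≈⟨ +-cong (abelSum₁-zero (W + x zero)) (trans (*-congˡ (arrangementSum-zero (x ∘ suc))) (*-identityʳ Z)) ⟩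
    (W + x zero) + Z
      ≈⟨ solve 3 (λ w c z → (w ⊕ c) ⊕ z ⊜ (z ⊕ c) ⊕ w) refl W (x zero) Z ⟩
    (Z + x zero) + W
      ≈⟨ +-cong arrangementSum₁ (abelSum₁-zero W) ⟨
    arrangementSum 1 x + abelSum 1 0 (x ∘ suc) W ∎
    where
    abelSum₁-zero : ∀ V → abelSum 1 0 (x ∘ suc) V ≈ V
    abelSum₁-zero V = trans (abelSum-zero 1 (x ∘ suc) V) (*-identityʳ V)
    arrangementSum₁ : arrangementSum 1 x ≈ Z + x zero
    arrangementSum₁ = trans (arrangementSum-suc x)
      (+-cong (*-identityʳ Z)
        (trans (+-identityʳ _) (trans (*-congˡ (arrangementSum-zero (x ∘ punchIn zero))) (*-identityʳ _))))

  abelSum₁Shift-suc : (n : ℕ) → AbelSum₀Formula (suc n) → AbelSum₁Shift n → AbelSum₁Shift (suc n)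
  abelSum₁Shift-suc n abelSum₀-sn abelSum₁-shift-n x W = begin
    F (W + x₀) + Z * E₁
      ≈⟨ +-cong (expand-F (W + x₀)) Z*E₁ ⟩
    ((W + x₀) * E₁ + Σ is (λ i → y i * L i ((W + x₀) + y i))) + (Z ^ suc (suc n) + Σ is (λ i → y i * (Z * E i)))
      ≈⟨ +-congʳ (+-cong (distribʳ E₁ W x₀)
           (Σ-cong is (λ i → *-congˡ (abelSum-cong 1 n (y ∘ punchIn i) (xy∙z≈xz∙y W x₀ (y i)))))) ⟩
    ((W * E₁ + x₀ * E₁) + Σ is (λ i → y i * L i ((W + y i) + x₀))) + (Z ^ suc (suc n) + Σ is (λ i → y i * (Z * E i)))
      ≈⟨ solve 5 (λ a b p z q → ((a ⊕ b) ⊕ p) ⊕ (z ⊕ q) ⊜ ((a ⊕ b) ⊕ z) ⊕ (p ⊕ q)) refl _ _ _ _ _ ⟩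
    ((W * E₁ + x₀ * E₁) + Z ^ suc (suc n)) + (Σ is (λ i → y i * L i ((W + y i) + x₀)) + Σ is (λ i → y i * (Z * E i)))
      ≈⟨ +-congˡ (Σ-*-+ is y _ _) ⟨
    ((W * E₁ + x₀ * E₁) + Z ^ suc (suc n)) + Σ is (λ i → y i * (L i ((W + y i) + x₀) + Z * E i))
      ≈⟨ +-congˡ (Σ-cong is (λ i → *-congˡ (abelSum₁-shift-n (x ∘ punchIn (suc i)) (W + y i)))) ⟩
    ((W * E₁ + x₀ * E₁) + Z ^ suc (suc n)) + Σ is (λ i → y i * (E′ i + L i (W + y i)))
      ≈⟨ +-congˡ (Σ-*-+ is y _ _) ⟩
    ((W * E₁ + x₀ * E₁) + Z ^ suc (suc n)) + (Σ is (λ i → y i * E′ i) + Σ is (λ i → y i * L i (W + y i)))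
      ≈⟨ solve 5 (λ a b z r t → ((a ⊕ b) ⊕ z) ⊕ (r ⊕ t) ⊜ (z ⊕ (b ⊕ r)) ⊕ (a ⊕ t)) refl _ _ _ _ _ ⟩
    (Z ^ suc (suc n) + (x₀ * E₁ + Σ is (λ i → y i * E′ i))) + (W * E₁ + Σ is (λ i → y i * L i (W + y i)))
      ≈⟨ +-cong expand-arrangementSum (expand-F W) ⟨
    arrangementSum (suc (suc n)) x + F W ∎
    where
    y : Fin (suc n) → Carrier
    y = x ∘ suc
    x₀ : Carrier
    x₀ = x zero
    is : List (Fin (suc n))
    is = allFin (suc n)
    F : Carrier → Carrier
    F = abelSum 1 (suc n) y
    E₁ : Carrier
    E₁ = arrangementSum (suc n) y
    L : Fin (suc n) → Carrier → Carrier
    L i = abelSum 1 n (y ∘ punchIn i)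
    E E′ : Fin (suc n) → Carrier
    E i = arrangementSum n (y ∘ punchIn i)
    E′ i = arrangementSum (suc n) (x ∘ punchIn (suc i))
    expand-F : ∀ V → F V ≈ V * E₁ + Σ is (λ i → y i * L i (V + y i))
    expand-F V = trans (abelSum-peel 0 n y V) (+-congʳ (*-congˡ (abelSum₀-sn y V)))
    Z*E₁ : Z * E₁ ≈ Z ^ suc (suc n) + Σ is (λ i → y i * (Z * E i))
    Z*E₁ = trans (*-congˡ (arrangementSum-suc y)) (trans (distribˡ _ _ _) (+-congˡ (*-Σ-central Z-central is y E)))
    expand-arrangementSum : arrangementSum (suc (suc n)) x ≈ Z ^ suc (suc n) + (x₀ * E₁ + Σ is (λ i → y i * E′ i))
    expand-arrangementSum = trans (arrangementSum-suc x)
      (+-congˡ (reflexive (Σ-allFin-suc (λ i → x i * arrangementSum (suc n) (x ∘ punchIn i)))))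

  abelSum₀≈arrangementSum : (n : ℕ) → AbelSum₀Formula n
  abelSum₁-shift : (n : ℕ) → AbelSum₁Shift n

  abelSum₀≈arrangementSum zero    = abelSum₀Formula-zero
  abelSum₀≈arrangementSum (suc n) = abelSum₀Formula-suc n (abelSum₀≈arrangementSum n) (abelSum₁-shift n)

  abelSum₁-shift zero    = abelSum₁Shift-zero
  abelSum₁-shift (suc n) = abelSum₁Shift-suc n (abelSum₀≈arrangementSum (suc n)) (abelSum₁-shift n)

theorem2p2 : {c ℓ : Level} (R : Ring c ℓ) (n : ℕ) (x : Fin n → Ring.Carrier R)
  (X Y : Ring.Carrier R) → Central R (Ring._+_ R X Y) →
  let open Ring R in
  Σ[_]_ R (allSubsets n)
    (λ S → pow R (X + sumOver R x S) ∣ S ∣ * pow R (Y + - sumOver R x S) (n ∸ ∣ S ∣))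
  ≈ Σ[_]_ R (upTo (suc n))
    (λ k → Σ[_]_ R (filter (unique? _≟_) (allTuples n k))
      (λ is → pow R (X + Y) (n ∸ k) * prodL R x is))
theorem2p2 R n x X Y X+Y-central = begin
  Σ (allSubsets n) (λ S → (X + sumOver R x S) ^ ∣ S ∣ * (Y - sumOver R x S) ^ (n ∸ ∣ S ∣))
    ≈⟨ Σ-cong (allSubsets n) (λ S → *-congˡ (^-cong (n ∸ ∣ S ∣) (sym ([x+y]-[x+z]≈y-z X Y (sumOver R x S))))) ⟩
  abelSum 0 n x X
    ≈⟨ abelSum₀≈arrangementSum n x X ⟩
  arrangementSum n x
    ≈⟨ Σ-cong (upTo (suc n)) (λ k → sym (Σ-*ˡ (filter (unique? _≟_) (allTuples n k)) _ (prodL R x))) ⟩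
  Σ (upTo (suc n)) (λ k → Σ (filter (unique? _≟_) (allTuples n k)) (λ is → (X + Y) ^ (n ∸ k) * prodL R x is)) ∎
  where
  open Ring R hiding (zero)
  open FiniteSums R
  open AbelIdentity R (X + Y) X+Y-central
  open import Relation.Binary.Reasoning.Setoid setoid
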